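{- Let $G$ be a planar graph with a fixed combinatorial embedding, $T$ a spanning tree of $G$, and $\nu$ a path cluster of $T$ with boundary vertices $u$ and $v$ satisfying the slim-path property. Then in the plane subgraph $G[\nu]$ (with the embedding induced from $G$), each of $u$ and $v$ is incident to a unique face, denoted $f_u^{\mathrm{des}}(\nu)$ and $f_v^{\mathrm{des}}(\nu)$ respectively. Moreover, every edge of $G$ that is not in $G[\nu]$ is contained in $f_u^{\mathrm{des}}(\nu)$ or in $f_v^{\mathrm{des}}(\nu)$.
   Context: A cluster is a connected subgraph $S$ of the spanning tree $T$; its boundary vertices are the vertices of $S$ incident to an edge of $T$ not in $S$, and a cluster has at most two boundary vertices. A path cluster is a cluster with exactly two boundary vertices $u,v$; its spine is the path in $T$ from $u$ to $v$. The slim-path property of a path cluster $\nu$ means: each boundary vertex is incident to exactly one edge of $T$ belonging to $\nu$, and this edge lies on the spine. The subgraph $G[\nu]$ consists of all edges of $G$ with both endpoints in the vertex set of $\nu$, except the edges not in $T$ that are incident to $u$ or $v$ (so $u$ and $v$ each have exactly one incident edge in $G[\nu]$). An edge of $G$ is contained in a face $f$ of the subgraph $G[\nu]$ if it lies in $f$ in any drawing of $G$ consistent with the combinatorial embedding. -}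

module Defs where

open import Data.Nat using (ℕ; zero; suc; _+_; _≤_; _<_)
open import Data.Fin using (Fin)
open import Data.Bool using (Bool; true; false; not)
open import Data.Product using (Σ; ∃; ∃-syntax; _×_; _,_; proj₁; proj₂)
open import Data.Sum using (_⊎_)
open import Data.List using (List; []; _∷_; length; map)
open import Data.List.Membership.Propositional using (_∈_)
open import Data.List.Relation.Unary.All using (All)
open import Data.List.Relation.Unary.AllPairs using (AllPairs)
open import Data.List.Relation.Unary.Unique.Propositional using (Unique)
open import Relation.Binary.PropositionalEquality using (_≡_; _≢_)
open import Relation.Nullary using (¬_)
open import Relation.Binary.Construct.Closure.ReflexiveTransitive using (Star)

-- Darts (half-edges) are pairs
-- (e , b); (e , true) is e directed src→tgt, (e , false) the reverse.

record Graph : Set where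
  field
    n   : ℕ
    m   : ℕ
    src : Fin m → Fin n
    tgt : Fin m → Fin n

Dart : Graph → Set
Dart G = Fin (Graph.m G) × Bool

rev : ∀ {G} → Dart G → Dart G
rev (e , b) = e , not b

iter : {A : Set} → (A → A) → ℕ → A → A
iter f zero x = x
iter f (suc k) x = f (iter f k x)

module _ (G : Graph) where
  open Graph G

  tail : Dart G → Fin n
  tail (e , true) = src e
  tail (e , false) = tgt e

  head : Dart G → Fin n
  head d = tail (rev {G} d)

  Incident : Fin m → Fin n → Set
  Incident e w = (src e ≡ w) ⊎ (tgt e ≡ w)

  Simple : Set
  Simple = (∀ e → src e ≢ tgt e)
         × (∀ e e' → ((src e ≡ src e' × tgt e ≡ tgt e') ⊎ (src e ≡ tgt e' × tgt e ≡ src e'))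
                   → e ≡ e')

  IsWalk : Fin n → List (Dart G) → Fin n → Set
  IsWalk x [] y = x ≡ y
  IsWalk x (d ∷ ds) y = (tail d ≡ x) × IsWalk (head d) ds y

  module _ (E : Fin m → Bool) where
    Adj : Fin n → Fin n → Set
    Adj x y = ∃[ d ] (E (proj₁ d) ≡ true × tail d ≡ x × head d ≡ y)

    HasCircuit : Set
    HasCircuit = ∃[ x ] ∃[ d ] ∃[ ds ]
      ( IsWalk x (d ∷ ds) x
      × All (λ d' → E (proj₁ d') ≡ true) (d ∷ ds)
      × Unique (map proj₁ (d ∷ ds)) )

    SpanningTree : Set
    SpanningTree = (∀ x y → Star Adj x y) × ¬ HasCircuit

    OnPath : Fin n → Fin n → Fin m → Set
    OnPath x y e = ∃[ ds ]
      ( IsWalk x ds y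
      × All (λ d' → E (proj₁ d') ≡ true) ds
      × Unique (x ∷ map head ds)
      × e ∈ map proj₁ ds )

-- Combinatorial embeddings (rotation systems).
-- σ is a permutation of the darts whose cycles are exactly the sets of
-- darts with a common tail (the cyclic order around each vertex).

record Rotation (G : Graph) : Set where
  field
    σ        : Dart G → Dart G
    σ⁻       : Dart G → Dart G
    σ⁻σ      : ∀ d → σ⁻ (σ d) ≡ d
    σσ⁻      : ∀ d → σ (σ⁻ d) ≡ d
    σ-tail   : ∀ d → tail G (σ d) ≡ tail G d
    σ-cyclic : ∀ d d' → tail G d ≡ tail G d' → ∃[ k ] (iter σ k d ≡ d')

module _ (G : Graph) (R : Rotation G) where
  open Graph G
  open Rotation R

  -- faces of G: orbits of the face permutation φ = σ ∘ rev
  FaceStep : Dart G → Dart G → Set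
  FaceStep d d' = σ (rev {G} d) ≡ d'

  SameFaceG : Dart G → Dart G → Set
  SameFaceG = Star FaceStep

  -- planar (genus 0) embedding of a connected graph:
  -- Euler's formula  n - m + (#faces) = 2
  Planar : Set
  Planar = ∃[ reps ]
    ( (∀ d → ∃[ r ] (r ∈ reps × SameFaceG r d))
    × AllPairs (λ r r' → ¬ SameFaceG r r') reps
    × n + length reps ≡ m + 2 )

module _ (G : Graph) (T : Fin (Graph.m G) → Bool)
         (VS : Fin (Graph.n G) → Bool) (ES : Fin (Graph.m G) → Bool) where
  open Graph G

  ConnectedSubgraphOfT : Set
  ConnectedSubgraphOfT =
      (∀ e → ES e ≡ true → T e ≡ true × VS (src e) ≡ true × VS (tgt e) ≡ true)
    × (∀ x y → VS x ≡ true → VS y ≡ true → Star (Adj G ES) x y)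

  Boundary : Fin n → Set
  Boundary w = VS w ≡ true × ∃[ e ] (T e ≡ true × ES e ≡ false × Incident G e w)

  PathCluster : Fin n → Fin n → Set
  PathCluster u v =
      ConnectedSubgraphOfT
    × u ≢ v
    × Boundary u × Boundary v
    × (∀ w → Boundary w → (w ≡ u) ⊎ (w ≡ v))

  -- w is incident to exactly one edge of T in S, and it lies on the
  -- spine (the T-path from u to v)
  SlimAt : Fin n → Fin n → Fin n → Set
  SlimAt u v w = ∃[ e ]
    ( ES e ≡ true × Incident G e w
    × (∀ e' → ES e' ≡ true → Incident G e' w → e' ≡ e)
    × OnPath G T u v e )

  SlimPath : Fin n → Fin n → Set
  SlimPath u v = SlimAt u v u × SlimAt u v v

module _ (G : Graph) (R : Rotation G) (T : Fin (Graph.m G) → Bool)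
         (VS : Fin (Graph.n G) → Bool) (u v : Fin (Graph.n G)) where
  open Graph G
  open Rotation R

  InH : Fin m → Set
  InH e = VS (src e) ≡ true × VS (tgt e) ≡ true
        × (T e ≡ false → ¬ Incident G e u × ¬ Incident G e v)

  HDart : Dart G → Set
  HDart d = InH (proj₁ d)

  -- induced rotation: the next dart of G[ν] after d in the rotation at tail d
  NextH : Dart G → Dart G → Set
  NextH d d' = ∃[ k ] ( 1 ≤ k × iter σ k d ≡ d' × HDart d'
                      × (∀ j → 1 ≤ j → j < k → ¬ HDart (iter σ j d)) )

  FaceStepH : Dart G → Dart G → Set
  FaceStepH d d' = HDart d × NextH (rev {G} d) d'

  SameFaceH : Dart G → Dart G → Set
  SameFaceH = Star FaceStepH

  FaceIncident : Fin n → Dart G → Set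
  FaceIncident w f = HDart f × ∃[ d ] (HDart d × tail G d ≡ w × SameFaceH f d)

  UniqueFaceAt : Fin n → Dart G → Set
  UniqueFaceAt w f = FaceIncident w f × (∀ g → FaceIncident w g → SameFaceH g f)

  data Reaches : Dart G → Dart G → Set where
    here  : ∀ {d} → VS (head G d) ≡ true → Reaches d d
    there : ∀ {d d' dk} → VS (head G d) ≡ false → tail G d' ≡ head G d
          → Reaches d' dk → Reaches d dk

  -- edge e (not in G[ν]) lies in the face of G[ν] represented by f:
  -- e is joined to G[ν] through G - V(G[ν]) and enters a vertex of G[ν]
  -- in an angle belonging to that face
  InFace : Fin m → Dart G → Set
  InFace e f = ∃[ b ] ∃[ dk ] ∃[ g ]
    ( Reaches (e , b) dk × NextH (rev {G} dk) g × SameFaceH f g )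

{-# OPTIONS --safe #-}
-- A tree edge outside ν joining two vertices of ν would have two boundary
-- endpoints, i.e. join u and v, and close a cycle with the spine.  Hence
-- every tree edge of G[ν] at u or v is an edge of ν, and by the slim-path
-- property u and v each have a single dart in G[ν], so a single face.  An
-- edge outside G[ν] either is a non-tree edge at u or v, or has an endpoint
-- outside ν, from which the tree path to u first enters ν through a tree
-- edge not in ν, i.e. at u or v.  Either way it arrives at u or v, where the
-- only angle of G[ν] belongs to the face of that single dart.
module Submission where

open import Defs
open import Data.Fin using (Fin)
open import Data.Fin.Properties using (_≟_)
open import Data.Bool using (Bool; true; false)
open import Data.Bool.Properties using (¬-not) renaming (_≟_ to _≟ᵇ_)
open import Data.Nat using (ℕ; zero; suc; _<_; s≤s; z≤n)
open import Data.Product using (∃-syntax; _×_; _,_; proj₁; proj₂)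
open import Data.Sum using (_⊎_; inj₁; inj₂)
open import Data.List using ([]; _∷_; map)
open import Data.List.Relation.Unary.Any using (here; there)
open import Data.List.Relation.Unary.All using (All; _∷_)
open import Data.List.Relation.Unary.All.Properties using (All¬⇒¬Any; ¬Any⇒All¬)
open import Data.List.Relation.Unary.AllPairs using ([]; _∷_)
open import Data.List.Relation.Unary.Unique.Propositional using (Unique)
open import Data.List.Membership.Propositional using (_∈_)
import Data.List.Membership.DecPropositional as DecMembership
open import Data.Empty using (⊥; ⊥-elim)
open import Function using (_∘_)
open import Relation.Binary.PropositionalEquality using (_≡_; _≢_; refl; sym; trans; cong; subst)
open import Relation.Binary.Construct.Closure.ReflexiveTransitive using (Star; ε; _◅_)
open import Relation.Nullary using (¬_; Dec; yes; no; contradiction)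
open import Relation.Nullary.Decidable using (_×-dec_; _⊎-dec_; _→-dec_; ¬?)
open import Relation.Unary using (Decidable)

least-witness : {P : ℕ → Set} → Decidable P → ∀ {k} → P k
              → ∃[ j ] (P j × (∀ {i} → i < j → ¬ P i))
least-witness P? {zero} p = zero , p , λ ()
least-witness P? {suc k} p with P? zero | least-witness (P? ∘ suc) p
... | yes p₀ | _ = zero , p₀ , λ ()
... | no ¬p₀ | j , pj , below = suc j , pj , λ { {zero} _ → ¬p₀ ; {suc i} (s≤s i<j) → below i<j }

module _ (G : Graph) where
  open Graph G

  tail⇒incident : ∀ d {w} → tail G d ≡ w → Incident G (proj₁ d) w
  tail⇒incident (e , true) = inj₁
  tail⇒incident (e , false) = inj₂

  head⇒incident : ∀ d {w} → head G d ≡ w → Incident G (proj₁ d) w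
  head⇒incident (e , true) = inj₂
  head⇒incident (e , false) = inj₁

  incident⇒tail⊎head : ∀ d {x} → Incident G (proj₁ d) x → x ≡ tail G d ⊎ x ≡ head G d
  incident⇒tail⊎head (e , true) (inj₁ refl) = inj₁ refl
  incident⇒tail⊎head (e , true) (inj₂ refl) = inj₂ refl
  incident⇒tail⊎head (e , false) (inj₁ refl) = inj₂ refl
  incident⇒tail⊎head (e , false) (inj₂ refl) = inj₁ refl

  incident? : ∀ e w → Dec (Incident G e w)
  incident? e w = (src e ≟ w) ⊎-dec (tgt e ≟ w)

  incident⇒dart-from : ∀ {e w} → Incident G e w → ∃[ d ] (proj₁ d ≡ e × tail G d ≡ w)
  incident⇒dart-from {e} (inj₁ p) = (e , true) , refl , p
  incident⇒dart-from {e} (inj₂ p) = (e , false) , refl , p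

  incident⇒dart-into : ∀ {e w} → Incident G e w → ∃[ b ] head G (e , b) ≡ w
  incident⇒dart-into (inj₁ p) = false , p
  incident⇒dart-into (inj₂ p) = true , p

  ends⇒tail : ∀ {P : Fin n → Set} d → P (src (proj₁ d)) → P (tgt (proj₁ d)) → P (tail G d)
  ends⇒tail (e , true) ps pt = ps
  ends⇒tail (e , false) ps pt = pt

  dart-≡ : (∀ e → src e ≢ tgt e) → ∀ d d' → proj₁ d ≡ proj₁ d' → tail G d ≡ tail G d' → d ≡ d'
  dart-≡ loopless (e , true) (.e , true) refl _ = refl
  dart-≡ loopless (e , false) (.e , false) refl _ = refl
  dart-≡ loopless (e , true) (.e , false) refl p = contradiction p (loopless e)
  dart-≡ loopless (e , false) (.e , true) refl p = contradiction (sym p) (loopless e)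

  incident⇒∈-walk : ∀ {x y e w} ds → IsWalk G x ds y → e ∈ map proj₁ ds → Incident G e w
                  → w ∈ x ∷ map (head G) ds
  incident⇒∈-walk (d ∷ ds) (refl , _) (here refl) inc with incident⇒tail⊎head d inc
  ... | inj₁ w≡tail = here w≡tail
  ... | inj₂ w≡head = there (here w≡head)
  incident⇒∈-walk (d ∷ ds) (_ , walk) (there e∈) inc = there (incident⇒∈-walk ds walk e∈ inc)

  walk-end∈heads : ∀ {x y} d ds → IsWalk G x (d ∷ ds) y → y ∈ map (head G) (d ∷ ds)
  walk-end∈heads d [] (_ , refl) = here refl
  walk-end∈heads d (d' ∷ ds) (_ , walk) = there (walk-end∈heads d' ds walk)

  path⇒edges-unique : ∀ {x y} ds → IsWalk G x ds y → Unique (x ∷ map (head G) ds)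
                    → Unique (map proj₁ ds)
  path⇒edges-unique [] _ _ = []
  path⇒edges-unique (d ∷ ds) (refl , walk) (x∉ ∷ distinct) =
    ¬Any⇒All¬ _ (All¬⇒¬Any x∉ ∘ λ e∈ → incident⇒∈-walk ds walk e∈ (tail⇒incident d refl))
    ∷ path⇒edges-unique ds walk distinct

  -- x occurs only at the start of the path and y only at its end.
  edge-joining-path-ends : ∀ {x y e} ds → IsWalk G x ds y → Unique (x ∷ map (head G) ds) → x ≢ y
                         → Incident G e x → Incident G e y → e ∈ map proj₁ ds
                         → map proj₁ ds ≡ e ∷ []
  edge-joining-path-ends (d ∷ ds) (refl , walk) (x∉ ∷ _) _ ex _ (there e∈) =
    contradiction (incident⇒∈-walk ds walk e∈ ex) (All¬⇒¬Any x∉)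
  edge-joining-path-ends (d ∷ ds) (refl , walk) distinct x≢y _ ey (here refl)
    with incident⇒tail⊎head d ey
  ... | inj₁ y≡tail = contradiction (sym y≡tail) x≢y
  edge-joining-path-ends (d ∷ []) _ _ _ _ _ (here refl) | inj₂ _ = refl
  edge-joining-path-ends (d ∷ d' ∷ ds) (_ , walk) (_ ∷ head∉ ∷ _) _ _ _ (here refl) | inj₂ y≡head =
    contradiction (subst (_∈ _) y≡head (walk-end∈heads d' ds walk)) (All¬⇒¬Any head∉)

  path+closing-edge⇒circuit : ∀ {E x y} c ds → E (proj₁ c) ≡ true → tail G c ≡ y → head G c ≡ x
                            → IsWalk G x ds y → All (λ d → E (proj₁ d) ≡ true) ds
                            → Unique (x ∷ map (head G) ds) → ¬ proj₁ c ∈ map proj₁ ds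
                            → HasCircuit G E
  path+closing-edge⇒circuit c ds Ec refl refl walk inE distinct c∉ =
    _ , c , ds , (refl , walk) , Ec ∷ inE , ¬Any⇒All¬ _ c∉ ∷ path⇒edges-unique ds walk distinct

module _ (G : Graph) (T : Fin (Graph.m G) → Bool)
         (VS : Fin (Graph.n G) → Bool) (ES : Fin (Graph.m G) → Bool) {u v : Fin (Graph.n G)} where
  open Graph G
  open DecMembership (_≟_ {m}) using (_∈?_)

  outer-tree-edge⇒dart-from-v-to-u : (∀ e → src e ≢ tgt e) → (∀ w → Boundary G T VS ES w → w ≡ u ⊎ w ≡ v)
    → ∀ e → T e ≡ true → ES e ≡ false → VS (src e) ≡ true → VS (tgt e) ≡ true
    → ∃[ d ] (proj₁ d ≡ e × tail G d ≡ v × head G d ≡ u)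
  outer-tree-edge⇒dart-from-v-to-u loopless boundary e Te e∉ES s∈VS t∈VS
    with boundary (src e) (s∈VS , e , Te , e∉ES , inj₁ refl)
       | boundary (tgt e) (t∈VS , e , Te , e∉ES , inj₂ refl)
  ... | inj₁ s≡u | inj₂ t≡v = (e , false) , refl , t≡v , s≡u
  ... | inj₂ s≡v | inj₁ t≡u = (e , true) , refl , s≡v , t≡u
  ... | inj₁ s≡u | inj₁ t≡u = contradiction (trans s≡u (sym t≡u)) (loopless e)
  ... | inj₂ s≡v | inj₂ t≡v = contradiction (trans s≡v (sym t≡v)) (loopless e)

  -- The closing edge could only lie on the spine by being the whole spine,
  -- but the spine contains the edge of ν at u.
  no-outer-tree-dart-from-v-to-u : ¬ HasCircuit G T → u ≢ v → SlimAt G T VS ES u v u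
    → ∀ d → T (proj₁ d) ≡ true → ES (proj₁ d) ≡ false → tail G d ≡ v → head G d ≡ u → ⊥
  no-outer-tree-dart-from-v-to-u acyclic u≢v
    (eᵤ , eᵤ∈ES , _ , _ , spine , walk , inT , distinct , eᵤ∈spine) d Td d∉ES tv hu
    with proj₁ d ∈? map proj₁ spine
  ... | no d∉spine = acyclic (path+closing-edge⇒circuit G d spine Td tv hu walk inT distinct d∉spine)
  ... | yes d∈spine
    with subst (eᵤ ∈_) (edge-joining-path-ends G spine walk distinct u≢v
                          (head⇒incident G d hu) (tail⇒incident G d tv) d∈spine) eᵤ∈spine
  ...   | here refl = contradiction (trans (sym eᵤ∈ES) d∉ES) λ ()

  tree-edge-within⇒cluster-edge : Simple G → ¬ HasCircuit G T → PathCluster G T VS ES u v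
    → SlimAt G T VS ES u v u
    → ∀ e → T e ≡ true → VS (src e) ≡ true → VS (tgt e) ≡ true → ES e ≡ true
  tree-edge-within⇒cluster-edge (loopless , _) acyclic (_ , u≢v , _ , _ , boundary) slim-u e Te s∈VS t∈VS
    with ES e in ES-e
  ... | true = refl
  ... | false with outer-tree-edge⇒dart-from-v-to-u loopless boundary e Te ES-e s∈VS t∈VS
  ...   | d , refl , tv , hu = ⊥-elim (no-outer-tree-dart-from-v-to-u acyclic u≢v slim-u d Te ES-e tv hu)

module InducedFaces (G : Graph) (R : Rotation G) (T : Fin (Graph.m G) → Bool)
                    (VS : Fin (Graph.n G) → Bool) (u v : Fin (Graph.n G)) where
  open Graph G
  open Rotation R

  SoleHDartAt : Fin n → Dart G → Set
  SoleHDartAt w f = HDart G R T VS u v f × tail G f ≡ w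
                  × (∀ d → HDart G R T VS u v d → tail G d ≡ w → d ≡ f)

  HDart? : Decidable (HDart G R T VS u v)
  HDart? (e , _) = (VS (src e) ≟ᵇ true) ×-dec (VS (tgt e) ≟ᵇ true)
                   ×-dec ((T e ≟ᵇ false) →-dec (¬? (incident? G e u) ×-dec ¬? (incident? G e v)))

  iter-σ-tail : ∀ k d → tail G (iter σ k d) ≡ tail G d
  iter-σ-tail zero d = refl
  iter-σ-tail (suc k) d = trans (σ-tail _) (iter-σ-tail k d)

  sole-H-dart⇒unique-face : ∀ {w f} → SoleHDartAt w f → UniqueFaceAt G R T VS u v w f
  sole-H-dart⇒unique-face {f = f} (Hf , tf , sole) =
    (Hf , f , Hf , tf , ε)
    , λ { g (_ , d , Hd , td , g~d) → subst (SameFaceH G R T VS u v g) (sole d Hd td) g~d }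

  sole-H-dart⇒next : ∀ {w f} → SoleHDartAt w f
                   → ∀ x → tail G x ≡ w → ¬ HDart G R T VS u v x → NextH G R T VS u v x f
  sole-H-dart⇒next {f = f} (Hf , tf , sole) x tx ¬Hx with σ-cyclic x f (trans tx (sym tf))
  ... | k , σᵏx≡f
    with least-witness (HDart? ∘ λ i → iter σ i x) {k} (subst (HDart G R T VS u v) (sym σᵏx≡f) Hf)
  ...   | zero , Hx , _ = contradiction Hx ¬Hx
  ...   | suc j , H , below =
    suc j , s≤s z≤n , sole _ H (trans (iter-σ-tail (suc j) x) tx) , Hf , λ _ _ → below

module PathClusterFaces (G : Graph) (R : Rotation G) (T : Fin (Graph.m G) → Bool)
                        (VS : Fin (Graph.n G) → Bool) (ES : Fin (Graph.m G) → Bool)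
                        (u v : Fin (Graph.n G)) where
  open Graph G
  open InducedFaces G R T VS u v

  slim⇒sole-H-dart : Simple G → ¬ HasCircuit G T → PathCluster G T VS ES u v
    → SlimAt G T VS ES u v u
    → ∀ {w} → w ≡ u ⊎ w ≡ v → SlimAt G T VS ES u v w → ∃[ f ] SoleHDartAt w f
  slim⇒sole-H-dart simple acyclic pc slim-u {w} w-end (e , e∈ES , e-w , e-unique , _)
    with incident⇒dart-from G e-w
  ... | f , refl , tf = f , H-f , tf , sole
    where
    H-f : HDart G R T VS u v f
    H-f with proj₁ (proj₁ pc) (proj₁ f) e∈ES
    ... | Tf , s∈ν , t∈ν = s∈ν , t∈ν , λ Tf≡false → contradiction (trans (sym Tf) Tf≡false) λ ()

    avoids : ∀ {e x} → x ≡ u ⊎ x ≡ v → ¬ Incident G e u × ¬ Incident G e v → ¬ Incident G e x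
    avoids (inj₁ refl) = proj₁
    avoids (inj₂ refl) = proj₂

    sole : ∀ d → HDart G R T VS u v d → tail G d ≡ w → d ≡ f
    sole d (s∈ν , t∈ν , non-tree-avoids-ends) td with T (proj₁ d) in Td
    ... | false = contradiction (tail⇒incident G d td) (avoids w-end (non-tree-avoids-ends refl))
    ... | true =
      dart-≡ G (proj₁ simple) d f (e-unique (proj₁ d) d∈ES (tail⇒incident G d td)) (trans td (sym tf))
      where
      d∈ES : ES (proj₁ d) ≡ true
      d∈ES = tree-edge-within⇒cluster-edge G T VS ES simple acyclic pc slim-u (proj₁ d) Td s∈ν t∈ν

  reaches-via-tree : ∀ d₀ {y} → VS (head G d₀) ≡ false → Star (Adj G T) (head G d₀) y → VS y ≡ true
    → ∃[ dk ] ( Reaches G R T VS u v d₀ dk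
              × T (proj₁ dk) ≡ true × VS (tail G dk) ≡ false × VS (head G dk) ≡ true)
  reaches-via-tree d₀ out ε y∈ν = contradiction (trans (sym y∈ν) out) λ ()
  reaches-via-tree d₀ out ((d , Td , td , refl) ◅ path) y∈ν with VS (head G d) in hd
  ... | true = d , there out td (here hd) , Td , trans (cong VS td) out , hd
  ... | false with reaches-via-tree d hd path y∈ν
  ...   | dk , reaches , entry = dk , there out td reaches , entry

  tree-dart-entering-ν : PathCluster G T VS ES u v
    → ∀ d → T (proj₁ d) ≡ true → VS (tail G d) ≡ false → VS (head G d) ≡ true
    → (head G d ≡ u ⊎ head G d ≡ v) × ¬ HDart G R T VS u v (rev {G} d)
  tree-dart-entering-ν ((ν-edges , _) , _ , _ , _ , boundary) d Td out d-in =
    boundary (head G d) (d-in , proj₁ d , Td , d∉ES , head⇒incident G d refl)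
    , λ (s , t , _) → tail-outside s t
    where
    tail-outside : VS (src (proj₁ d)) ≡ true → VS (tgt (proj₁ d)) ≡ true → ⊥
    tail-outside s t = contradiction (trans (sym (ends⇒tail G {λ x → VS x ≡ true} d s t)) out) λ ()
    d∉ES : ES (proj₁ d) ≡ false
    d∉ES with ES (proj₁ d) in d∈ES
    ... | false = refl
    ... | true with ν-edges (proj₁ d) d∈ES
    ...   | _ , s , t = ⊥-elim (tail-outside s t)

  ReachesBoundary : Dart G → Set
  ReachesBoundary d = ∃[ dk ] ( Reaches G R T VS u v d dk
                              × (head G dk ≡ u ⊎ head G dk ≡ v) × ¬ HDart G R T VS u v (rev {G} dk))

  leaving-ν⇒reaches-boundary : SpanningTree G T → PathCluster G T VS ES u v
    → ∀ d → VS (head G d) ≡ false → ReachesBoundary d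
  leaving-ν⇒reaches-boundary (connected , _) pc@(_ , _ , (u∈ν , _) , _) d out
    with reaches-via-tree d out (connected (head G d) u) u∈ν
  ... | dk , reaches , Tdk , tail-out , head-in =
    dk , reaches , tree-dart-entering-ν pc dk Tdk tail-out head-in

  non-H-edge-at-boundary⇒reaches-boundary : ∀ {e w} → VS (src e) ≡ true → VS (tgt e) ≡ true
    → ¬ InH G R T VS u v e → w ≡ u ⊎ w ≡ v → Incident G e w → ∃[ b ] ReachesBoundary (e , b)
  non-H-edge-at-boundary⇒reaches-boundary {e} s t e∉H w-end e-w with incident⇒dart-into G e-w
  ... | b , refl =
    b , (e , b) , here (ends⇒tail G {λ x → VS x ≡ true} (rev {G} (e , b)) s t) , w-end , e∉H

  non-H-edge⇒reaches-boundary : SpanningTree G T → PathCluster G T VS ES u v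
    → ∀ e → ¬ InH G R T VS u v e → ∃[ b ] ReachesBoundary (e , b)
  non-H-edge⇒reaches-boundary tree pc e e∉H with VS (src e) ≟ᵇ true | VS (tgt e) ≟ᵇ true
  ... | no s∉ν | _ = false , leaving-ν⇒reaches-boundary tree pc (e , false) (¬-not s∉ν)
  ... | yes _ | no t∉ν = true , leaving-ν⇒reaches-boundary tree pc (e , true) (¬-not t∉ν)
  ... | yes s∈ν | yes t∈ν with incident? G e u | incident? G e v
  ...   | yes e-u | _ = non-H-edge-at-boundary⇒reaches-boundary s∈ν t∈ν e∉H (inj₁ refl) e-u
  ...   | no _ | yes e-v = non-H-edge-at-boundary⇒reaches-boundary s∈ν t∈ν e∉H (inj₂ refl) e-v
  ...   | no ¬e-u | no ¬e-v = contradiction (s∈ν , t∈ν , λ _ → ¬e-u , ¬e-v) e∉H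

  reaches-boundary⇒in-face : ∀ {fu fv e b} → SoleHDartAt u fu → SoleHDartAt v fv
    → ReachesBoundary (e , b) → InFace G R T VS u v e fu ⊎ InFace G R T VS u v e fv
  reaches-boundary⇒in-face {b = b} sole-u _ (dk , reaches , inj₁ at-u , ¬H) =
    inj₁ (b , dk , _ , reaches , sole-H-dart⇒next sole-u (rev {G} dk) at-u ¬H , ε)
  reaches-boundary⇒in-face {b = b} _ sole-v (dk , reaches , inj₂ at-v , ¬H) =
    inj₂ (b , dk , _ , reaches , sole-H-dart⇒next sole-v (rev {G} dk) at-v ¬H , ε)

lemma1 : (G : Graph) → Simple G → (R : Rotation G) → Planar G R
       → (T : Fin (Graph.m G) → Bool) → SpanningTree G T
       → (VS : Fin (Graph.n G) → Bool) (ES : Fin (Graph.m G) → Bool)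
       → (u v : Fin (Graph.n G))
       → PathCluster G T VS ES u v → SlimPath G T VS ES u v
       → ∃[ fu ] ∃[ fv ]
           ( UniqueFaceAt G R T VS u v u fu
           × UniqueFaceAt G R T VS u v v fv
           × (∀ e → ¬ InH G R T VS u v e
                  → InFace G R T VS u v e fu ⊎ InFace G R T VS u v e fv) )
lemma1 G simple R _ T tree VS ES u v pc (slim-u , slim-v) =
  let open InducedFaces G R T VS u v
      open PathClusterFaces G R T VS ES u v
      (fu , sole-u) = slim⇒sole-H-dart simple (proj₂ tree) pc slim-u (inj₁ refl) slim-u
      (fv , sole-v) = slim⇒sole-H-dart simple (proj₂ tree) pc slim-u (inj₂ refl) slim-v
  in fu , fv , sole-H-dart⇒unique-face sole-u , sole-H-dart⇒unique-face sole-v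
   , λ e e∉H → reaches-boundary⇒in-face sole-u sole-v (proj₂ (non-H-edge⇒reaches-boundary tree pc e e∉H))
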